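{- Let $(K,T,+,;,{}^*,\rightarrow,0,1)$ be an idempotent graded Kleene algebra with tests (I-GKAT). Then for all $b,c\in T$ and $p\in K$: if $b;c;p\leq b;c;p;c$, then $c;(b;p)^*;(b\rightarrow 0)\leq c;(b;p)^*;(b\rightarrow 0);(b\rightarrow 0);c$.
   Context: A graded Kleene algebra with tests (GKAT) is a tuple $(K,T,+,;,{}^*,\rightarrow,0,1)$ where $K$ is a set, $T\subseteq K$, $0,1\in T$, $+$ and $;$ are binary operations on $K$ under which $T$ is closed, ${}^*$ is a unary operation on $K$, and $\rightarrow$ is a binary operation on $T$ with values in $T$, such that for all $p,q,r\in K$ and $a,b,c\in T$: $p+(q+r)=(p+q)+r$; $p+q=q+p$; $p;(q;r)=(p;q);r$; $p;1=1;p=p$; $p;(q+r)=p;q+p;r$; $(p+q);r=p;r+q;r$; $p;0=0;p=0$; $1+p;p^*=p^*$; $q+p;r\leq r\Rightarrow p^*;q\leq r$; $q+r;p\leq r\Rightarrow q;p^*\leq r$; $a;b\leq c\Leftrightarrow b\leq a\rightarrow c$; $a\leq 1$; $a;b=b;a$. Here $p\leq q$ means $p+q=q$, and $;$ binds more tightly than $+$. An idempotent GKAT (I-GKAT) is a GKAT that additionally satisfies $a;a=a$ for all $a\in T$. -}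

module Defs where

open import Level using (Level; suc; _⊔_)
open import Relation.Binary.PropositionalEquality using (_≡_)

-- K is the carrier; T ⊆ K is given as a predicate IsTest on K.
-- The operation → is only specified on tests: it is given as a function
-- taking two elements together with proofs that they are tests.
record GKAT (c ℓ : Level) : Set (suc (c ⊔ ℓ)) where
  infixl 6 _+_
  infixl 7 _︔_
  infix  4 _≤_
  field
    K      : Set c
    IsTest : K → Set ℓ
    _+_    : K → K → K
    _︔_    : K → K → K
    _⋆     : K → K
    𝟘 𝟙    : K
    _⇒_    : (a b : K) → IsTest a → IsTest b → K

  _≤_ : K → K → Set c
  p ≤ q = p + q ≡ q

  field
    𝟘-test   : IsTest 𝟘
    𝟙-test   : IsTest 𝟙
    +-test   : ∀ {a b} → IsTest a → IsTest b → IsTest (a + b)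
    ︔-test   : ∀ {a b} → IsTest a → IsTest b → IsTest (a ︔ b)
    ⇒-test   : ∀ {a b} (ta : IsTest a) (tb : IsTest b) → IsTest ((a ⇒ b) ta tb)

    +-assoc  : ∀ p q r → p + (q + r) ≡ (p + q) + r
    +-comm   : ∀ p q → p + q ≡ q + p
    ︔-assoc  : ∀ p q r → p ︔ (q ︔ r) ≡ (p ︔ q) ︔ r
    ︔-identityʳ : ∀ p → p ︔ 𝟙 ≡ p
    ︔-identityˡ : ∀ p → 𝟙 ︔ p ≡ p
    distribˡ : ∀ p q r → p ︔ (q + r) ≡ p ︔ q + p ︔ r
    distribʳ : ∀ p q r → (p + q) ︔ r ≡ p ︔ r + q ︔ r
    zeroʳ    : ∀ p → p ︔ 𝟘 ≡ 𝟘
    zeroˡ    : ∀ p → 𝟘 ︔ p ≡ 𝟘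
    star-unfold : ∀ p → 𝟙 + p ︔ (p ⋆) ≡ p ⋆
    star-indˡ : ∀ p q r → q + p ︔ r ≤ r → (p ⋆) ︔ q ≤ r
    star-indʳ : ∀ p q r → q + r ︔ p ≤ r → q ︔ (p ⋆) ≤ r
    residual-to   : ∀ {a b c} (ta : IsTest a) (tb : IsTest b) (tc : IsTest c) →
                    a ︔ b ≤ c → b ≤ (a ⇒ c) ta tc
    residual-from : ∀ {a b c} (ta : IsTest a) (tb : IsTest b) (tc : IsTest c) →
                    b ≤ (a ⇒ c) ta tc → a ︔ b ≤ c
    test-≤𝟙  : ∀ {a} → IsTest a → a ≤ 𝟙
    test-comm : ∀ {a b} → IsTest a → IsTest b → a ︔ b ≡ b ︔ a

record IGKAT (c ℓ : Level) : Set (suc (c ⊔ ℓ)) where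
  field
    gkat : GKAT c ℓ
  open GKAT gkat public
  field
    test-idem : ∀ {a} → IsTest a → a ︔ a ≡ a

-- The hypothesis says that the test d can be pushed past the loop body b ; p,
-- i.e. d ; (b ; p) ≤ (b ; p) ; d.  Star induction extends this to the whole
-- loop, d ; (b ; p)⋆ ≤ (b ; p)⋆ ; d, and because tests are idempotent d can
-- then be kept in front as well: d ; (b ; p)⋆ = d ; d ; (b ; p)⋆ ≤ d ; (b ; p)⋆ ; d.
-- The remaining rearrangement only uses that tests commute and are idempotent.
module Submission where

open import Defs
open import Relation.Binary.PropositionalEquality
import Relation.Binary.Reasoning.Base.Single as SingleReasoning
open import Relation.Binary.Reasoning.Syntax using (module ≤-syntax)

module GKATProperties {c ℓ} (G : GKAT c ℓ) where
  open GKAT G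

  +-idem : ∀ p → p + p ≡ p
  +-idem p = begin
    p + p             ≡⟨ cong₂ _+_ (sym (︔-identityʳ p)) (sym (︔-identityʳ p)) ⟩
    p ︔ 𝟙 + p ︔ 𝟙     ≡⟨ sym (distribˡ p 𝟙 𝟙) ⟩
    p ︔ (𝟙 + 𝟙)       ≡⟨ cong (p ︔_) (test-≤𝟙 𝟙-test) ⟩
    p ︔ 𝟙             ≡⟨ ︔-identityʳ p ⟩
    p                 ∎
    where open ≡-Reasoning

  ≤-reflexive : ∀ {p q} → p ≡ q → p ≤ q
  ≤-reflexive {p} refl = +-idem p

  ≤-refl : ∀ {p} → p ≤ p
  ≤-refl = ≤-reflexive refl

  ≤-trans : ∀ {p q r} → p ≤ q → q ≤ r → p ≤ r
  ≤-trans {p} {q} {r} p≤q q≤r = begin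
    p + r          ≡⟨ cong (p +_) (sym q≤r) ⟩
    p + (q + r)    ≡⟨ +-assoc p q r ⟩
    (p + q) + r    ≡⟨ cong (_+ r) p≤q ⟩
    q + r          ≡⟨ q≤r ⟩
    r              ∎
    where open ≡-Reasoning

  module ≤-Reasoning where
    open SingleReasoning _≤_ ≤-refl ≤-trans public hiding (step-∼)
    open ≤-syntax _IsRelatedTo_ _IsRelatedTo_ ∼-go public

  +-lub : ∀ {p q r} → p ≤ r → q ≤ r → p + q ≤ r
  +-lub {p} {q} {r} p≤r q≤r = trans (sym (+-assoc p q r)) (trans (cong (p +_) q≤r) p≤r)

  x≤x+y : ∀ p q → p ≤ p + q
  x≤x+y p q = trans (+-assoc p p q) (cong (_+ q) (+-idem p))

  x≤y+x : ∀ p q → p ≤ q + p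
  x≤y+x p q = ≤-trans (x≤x+y p q) (≤-reflexive (+-comm p q))

  ︔-monoˡ-≤ : ∀ {p q} r → p ≤ q → p ︔ r ≤ q ︔ r
  ︔-monoˡ-≤ {p} {q} r p≤q = trans (sym (distribʳ p q r)) (cong (_︔ r) p≤q)

  ︔-monoʳ-≤ : ∀ {p q} r → p ≤ q → r ︔ p ≤ r ︔ q
  ︔-monoʳ-≤ {p} {q} r p≤q = trans (sym (distribˡ r p q)) (cong (r ︔_) p≤q)

  test-︔-≤ : ∀ {a} → IsTest a → ∀ p → a ︔ p ≤ p
  test-︔-≤ ta p = ≤-trans (︔-monoˡ-≤ p (test-≤𝟙 ta)) (≤-reflexive (︔-identityˡ p))

  𝟙≤⋆ : ∀ q → 𝟙 ≤ q ⋆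
  𝟙≤⋆ q = ≤-trans (x≤x+y 𝟙 (q ︔ q ⋆)) (≤-reflexive (star-unfold q))

  ︔⋆≤⋆ : ∀ q → q ︔ q ⋆ ≤ q ⋆
  ︔⋆≤⋆ q = ≤-trans (x≤y+x (q ︔ q ⋆) 𝟙) (≤-reflexive (star-unfold q))

  ⋆︔≤⋆ : ∀ q → q ⋆ ︔ q ≤ q ⋆
  ⋆︔≤⋆ q = star-indˡ q q (q ⋆) (+-lub q≤⋆ (︔⋆≤⋆ q))
    where
    q≤⋆ : q ≤ q ⋆
    q≤⋆ = ≤-trans (≤-reflexive (sym (︔-identityʳ q)))
                  (≤-trans (︔-monoʳ-≤ q (𝟙≤⋆ q)) (︔⋆≤⋆ q))

  ⋆-simulation : ∀ x q → x ︔ q ≤ q ︔ x → x ︔ q ⋆ ≤ q ⋆ ︔ x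
  ⋆-simulation x q xq≤qx = star-indʳ q x (q ⋆ ︔ x) (+-lub x≤⋆x loop)
    where
    open ≤-Reasoning

    x≤⋆x : x ≤ q ⋆ ︔ x
    x≤⋆x = ≤-trans (≤-reflexive (sym (︔-identityˡ x))) (︔-monoˡ-≤ x (𝟙≤⋆ q))

    loop : q ⋆ ︔ x ︔ q ≤ q ⋆ ︔ x
    loop = begin
      q ⋆ ︔ x ︔ q      ≡⟨ sym (︔-assoc (q ⋆) x q) ⟩
      q ⋆ ︔ (x ︔ q)    ≤⟨ ︔-monoʳ-≤ (q ⋆) xq≤qx ⟩
      q ⋆ ︔ (q ︔ x)    ≡⟨ ︔-assoc (q ⋆) q x ⟩
      q ⋆ ︔ q ︔ x      ≤⟨ ︔-monoˡ-≤ x (⋆︔≤⋆ q) ⟩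
      q ⋆ ︔ x          ∎

  guarded-commute : ∀ {b d} → IsTest b → IsTest d → ∀ p →
    b ︔ d ︔ p ≤ b ︔ d ︔ p ︔ d → d ︔ (b ︔ p) ≤ b ︔ p ︔ d
  guarded-commute {b} {d} tb td p hyp = begin
    d ︔ (b ︔ p)        ≡⟨ ︔-assoc d b p ⟩
    d ︔ b ︔ p          ≡⟨ cong (_︔ p) (test-comm td tb) ⟩
    b ︔ d ︔ p          ≤⟨ hyp ⟩
    b ︔ d ︔ p ︔ d      ≡⟨ cong (λ x → x ︔ p ︔ d) (test-comm tb td) ⟩
    d ︔ b ︔ p ︔ d      ≡⟨ cong (_︔ d) (sym (︔-assoc d b p)) ⟩
    d ︔ (b ︔ p) ︔ d    ≡⟨ sym (︔-assoc d (b ︔ p) d) ⟩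
    d ︔ (b ︔ p ︔ d)    ≤⟨ test-︔-≤ td (b ︔ p ︔ d) ⟩
    b ︔ p ︔ d          ∎
    where open ≤-Reasoning

module IGKATProperties {c ℓ} (A : IGKAT c ℓ) where
  open IGKAT A
  open GKATProperties gkat public

  ⋆-simulation-test : ∀ {d} → IsTest d → ∀ q → d ︔ q ≤ q ︔ d → d ︔ q ⋆ ≤ d ︔ q ⋆ ︔ d
  ⋆-simulation-test {d} td q dq≤qd = begin
    d ︔ q ⋆              ≡⟨ cong (_︔ q ⋆) (sym (test-idem td)) ⟩
    d ︔ d ︔ q ⋆          ≡⟨ sym (︔-assoc d d (q ⋆)) ⟩
    d ︔ (d ︔ q ⋆)        ≤⟨ ︔-monoʳ-≤ d (⋆-simulation d q dq≤qd) ⟩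
    d ︔ (q ⋆ ︔ d)        ≡⟨ ︔-assoc d (q ⋆) d ⟩
    d ︔ q ⋆ ︔ d          ∎
    where open ≤-Reasoning

theorem2 : ∀ {c ℓ} (A : IGKAT c ℓ) → let open IGKAT A in
    ∀ {b d : K} (tb : IsTest b) (td : IsTest d) (p : K) →
    b ︔ d ︔ p ≤ b ︔ d ︔ p ︔ d →
    d ︔ ((b ︔ p) ⋆) ︔ (b ⇒ 𝟘) tb 𝟘-test
      ≤ d ︔ ((b ︔ p) ⋆) ︔ (b ⇒ 𝟘) tb 𝟘-test ︔ (b ⇒ 𝟘) tb 𝟘-test ︔ d
theorem2 A {b} {d} tb td p hyp = begin
  d ︔ X ︔ n             ≤⟨ ︔-monoˡ-≤ n (⋆-simulation-test td (b ︔ p) (guarded-commute tb td p hyp)) ⟩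
  d ︔ X ︔ d ︔ n         ≡⟨ sym (︔-assoc (d ︔ X) d n) ⟩
  d ︔ X ︔ (d ︔ n)       ≡⟨ cong (d ︔ X ︔_) (test-comm td tn) ⟩
  d ︔ X ︔ (n ︔ d)       ≡⟨ ︔-assoc (d ︔ X) n d ⟩
  d ︔ X ︔ n ︔ d         ≡⟨ cong (λ x → d ︔ X ︔ x ︔ d) (sym (test-idem tn)) ⟩
  d ︔ X ︔ (n ︔ n) ︔ d   ≡⟨ cong (_︔ d) (︔-assoc (d ︔ X) n n) ⟩
  d ︔ X ︔ n ︔ n ︔ d     ∎
  where
  open IGKAT A
  open IGKATProperties A
  open ≤-Reasoning
  X = (b ︔ p) ⋆
  n = (b ⇒ 𝟘) tb 𝟘-test
  tn = ⇒-test tb 𝟘-test
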